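{- (a) Let $S_1,S_2,S_3$ be NAA. Then $[\![S_1\wedge S_2]\!]=[\![S_1]\!]\cap[\![S_2]\!]$, and $S_1\le_m S_2\wedge S_3$ iff $S_1\le_m S_2$ and $S_1\le_m S_3$. (b) The same two statements hold when $S_1,S_2,S_3$ are DMTS.
   Context: Fix a finite alphabet $\Sigma$. NAA: $(S,S^0,\mathrm{Tran})$, $S^0\subseteq S$ finite, $\mathrm{Tran}:S\to 2^{\mathcal P_{\mathrm{fin}}(\Sigma\times S)}$; NAA modal refinement $R$: for $(s_1,s_2)\in R$ and $M_1\in\mathrm{Tran}_1(s_1)$ there is $M_2\in\mathrm{Tran}_2(s_2)$ with each $(a,t_1)\in M_1$ matched by some $(a,t_2)\in M_2$ with $(t_1,t_2)\in R$ and vice versa. DMTS: $(S,S^0,\dashrightarrow,\longrightarrow)$, $S^0$ finite, image-finite may relation $\dashrightarrow\subseteq S\times\Sigma\times S$, must relation $\longrightarrow\subseteq S\times2^{\Sigma\times S}$ with $s\longrightarrow N,(a,t)\in N\Rightarrow s\overset a\dashrightarrow t$; DMTS modal refinement $R$: for $(s_1,s_2)\in R$, each $s_1\overset a\dashrightarrow t_1$ has $s_2\overset a\dashrightarrow t_2$ with $(t_1,t_2)\in R$, and each $s_2\longrightarrow N_2$ has $s_1\longrightarrow N_1$ such that each $(a,t_1)\in N_1$ has $(a,t_2)\in N_2$ with $(t_1,t_2)\in R$. Initialised: every left initial state related to some right initial state; $S_1\le_m S_2$ iff an initialised refinement exists. LTS $(I,i^0,\to)$ (image-finite) are NAA with initial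 set $\{i^0\}$ and $\mathrm{Tran}(s)=\{\{(a,t)\mid s\xrightarrow at\}\}$, resp. DMTS with may $=\to$ and must $=\{(s,\{(a,t)\})\mid s\xrightarrow at\}$; $[\![S]\!]=\{I \text{ LTS}\mid I\le_m S\}$. DMTS conjunction: $S_1\wedge S_2=(S_1\times S_2,S_1^0\times S_2^0,\dashrightarrow,\longrightarrow)$ with $(s_1,s_2)\overset a\dashrightarrow(t_1,t_2)$ iff $s_1\overset a\dashrightarrow_1t_1$ and $s_2\overset a\dashrightarrow_2t_2$; for every $s_1\longrightarrow_1N_1$, $(s_1,s_2)\longrightarrow\{(a,(t_1,t_2))\mid(a,t_1)\in N_1,(s_1,s_2)\overset a\dashrightarrow(t_1,t_2)\}$; symmetrically for every $s_2\longrightarrow_2N_2$; no other must transitions. NAA conjunction: $S_1\wedge S_2=(S_1\times S_2,S_1^0\times S_2^0,\mathrm{Tran})$, $\mathrm{Tran}((s_1,s_2))=\{M\subseteq\Sigma\times S_1\times S_2\mid\pi_1(M)\in\mathrm{Tran}_1(s_1),\pi_2(M)\in\mathrm{Tran}_2(s_2)\}$ where $\pi_1(M)=\{(a,s_1)\mid\exists s_2:(a,s_1,s_2)\in M\}$, $\pi_2(M)=\{(a,s_2)\mid\exists s_1:(a,s_1,s_2)\in M\}$. -}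

module Defs where

open import Level using (0ℓ)
open import Data.Product using (Σ; ∃; ∃-syntax; _×_; _,_; proj₁; proj₂)
open import Data.Sum using (_⊎_; inj₁; inj₂)
open import Data.List using (List; map; cartesianProduct)
open import Data.List.Membership.Propositional using (_∈_)
open import Data.List.Relation.Binary.BagAndSetEquality using (_∼[_]_; set)
open import Function.Bundles using (_⇔_)
open import Relation.Binary.PropositionalEquality using (_≡_)

-- Labelled transition systems (image-finite: successors given as a list)

record LTS (A : Set) : Set₁ where
  field
    I    : Set
    i⁰   : I
    step : I → List (A × I)

-- Nondeterministic acceptance automata
-- A finite subset of Σ × S is represented by a list (read as a set);
-- Tran s is a predicate on such lists (a set of finite sets).

record NAA (A : Set) : Set₁ where
  field
    S    : Set
    S⁰   : List S
    Tran : S → List (A × S) → Set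

module _ {A : Set} where

  IsNAARefinement : (S₁ S₂ : NAA A) → (NAA.S S₁ → NAA.S S₂ → Set) → Set
  IsNAARefinement S₁ S₂ R =
    ∀ s₁ s₂ → R s₁ s₂ →
    ∀ M₁ → NAA.Tran S₁ s₁ M₁ →
    ∃[ M₂ ] (NAA.Tran S₂ s₂ M₂
      × (∀ a t₁ → (a , t₁) ∈ M₁ → ∃[ t₂ ] ((a , t₂) ∈ M₂ × R t₁ t₂))
      × (∀ a t₂ → (a , t₂) ∈ M₂ → ∃[ t₁ ] ((a , t₁) ∈ M₁ × R t₁ t₂)))

  InitialisedNAA : (S₁ S₂ : NAA A) → (NAA.S S₁ → NAA.S S₂ → Set) → Set
  InitialisedNAA S₁ S₂ R =
    ∀ s₁ → s₁ ∈ NAA.S⁰ S₁ → ∃[ s₂ ] (s₂ ∈ NAA.S⁰ S₂ × R s₁ s₂)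

  _≤NAA_ : NAA A → NAA A → Set₁
  S₁ ≤NAA S₂ = ∃[ R ] (IsNAARefinement S₁ S₂ R × InitialisedNAA S₁ S₂ R)

  LTS→NAA : LTS A → NAA A
  LTS→NAA L = record
    { S    = LTS.I L
    ; S⁰   = LTS.i⁰ L Data.List.∷ Data.List.[]
    ; Tran = λ s M → M ≡ LTS.step L s
    }

  _∈⟦_⟧NAA : LTS A → NAA A → Set₁
  I ∈⟦ S ⟧NAA = LTS→NAA I ≤NAA S

  π₁ : {S₁ S₂ : Set} → List (A × S₁ × S₂) → List (A × S₁)
  π₁ = map (λ { (a , s₁ , s₂) → (a , s₁) })

  π₂ : {S₁ S₂ : Set} → List (A × S₁ × S₂) → List (A × S₂)
  π₂ = map (λ { (a , s₁ , s₂) → (a , s₂) })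

  -- NAA conjunction.  "π₁(M) ∈ Tran₁(s₁)" : the finite set π₁(M) is
  -- (set-)equal to some finite set in Tran₁(s₁).
  _∧NAA_ : NAA A → NAA A → NAA A
  S₁ ∧NAA S₂ = record
    { S    = NAA.S S₁ × NAA.S S₂
    ; S⁰   = cartesianProduct (NAA.S⁰ S₁) (NAA.S⁰ S₂)
    ; Tran = λ { (s₁ , s₂) M →
        (∃[ M₁ ] (NAA.Tran S₁ s₁ M₁ × π₁ M ∼[ set ] M₁))
        × (∃[ M₂ ] (NAA.Tran S₂ s₂ M₂ × π₂ M ∼[ set ] M₂)) }
    }

-- Disjunctive modal transition systems
-- may : predicate on (a , t) for each s;  must: a family of subsets of
-- Σ × S for each s (indexed by MustIx s), each contained in the may
-- successors.

record DMTS (A : Set) : Set₁ where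
  field
    S       : Set
    S⁰      : List S
    may     : S → A × S → Set
    MustIx  : S → Set
    must    : (s : S) → MustIx s → A × S → Set
    must⊆may : ∀ s i x → must s i x → may s x

module _ {A : Set} where

  ImageFinite : DMTS A → Set
  ImageFinite D = ∀ s → ∃[ L ] (∀ x → DMTS.may D s x ⇔ x ∈ L)

  IsDMTSRefinement : (S₁ S₂ : DMTS A) → (DMTS.S S₁ → DMTS.S S₂ → Set) → Set
  IsDMTSRefinement S₁ S₂ R =
    ∀ s₁ s₂ → R s₁ s₂ →
      (∀ a t₁ → DMTS.may S₁ s₁ (a , t₁) →
         ∃[ t₂ ] (DMTS.may S₂ s₂ (a , t₂) × R t₁ t₂))
    × (∀ (j : DMTS.MustIx S₂ s₂) → ∃[ i ]
         (∀ a t₁ → DMTS.must S₁ s₁ i (a , t₁) →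
            ∃[ t₂ ] (DMTS.must S₂ s₂ j (a , t₂) × R t₁ t₂)))

  InitialisedDMTS : (S₁ S₂ : DMTS A) → (DMTS.S S₁ → DMTS.S S₂ → Set) → Set
  InitialisedDMTS S₁ S₂ R =
    ∀ s₁ → s₁ ∈ DMTS.S⁰ S₁ → ∃[ s₂ ] (s₂ ∈ DMTS.S⁰ S₂ × R s₁ s₂)

  _≤DMTS_ : DMTS A → DMTS A → Set₁
  S₁ ≤DMTS S₂ = ∃[ R ] (IsDMTSRefinement S₁ S₂ R × InitialisedDMTS S₁ S₂ R)

  LTS→DMTS : LTS A → DMTS A
  LTS→DMTS L = record
    { S        = LTS.I L
    ; S⁰       = LTS.i⁰ L Data.List.∷ Data.List.[]
    ; may      = λ s x → x ∈ LTS.step L s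
    ; MustIx   = λ s → ∃[ x ] (x ∈ LTS.step L s)
    ; must     = λ s i y → y ≡ proj₁ i
    ; must⊆may = λ { s (x , x∈) .x Relation.Binary.PropositionalEquality.refl → x∈ }
    }

  _∈⟦_⟧DMTS : LTS A → DMTS A → Set₁
  I ∈⟦ S ⟧DMTS = LTS→DMTS I ≤DMTS S

  _∧DMTS_ : DMTS A → DMTS A → DMTS A
  S₁ ∧DMTS S₂ = record
    { S        = DMTS.S S₁ × DMTS.S S₂
    ; S⁰       = cartesianProduct (DMTS.S⁰ S₁) (DMTS.S⁰ S₂)
    ; may      = mayC
    ; MustIx   = λ { (s₁ , s₂) → DMTS.MustIx S₁ s₁ ⊎ DMTS.MustIx S₂ s₂ }
    ; must     = mustC
    ; must⊆may = must⊆mayC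
    }
    where
    mayC : DMTS.S S₁ × DMTS.S S₂ → A × (DMTS.S S₁ × DMTS.S S₂) → Set
    mayC (s₁ , s₂) (a , t₁ , t₂) = DMTS.may S₁ s₁ (a , t₁) × DMTS.may S₂ s₂ (a , t₂)

    mustC : (s : DMTS.S S₁ × DMTS.S S₂) →
            DMTS.MustIx S₁ (proj₁ s) ⊎ DMTS.MustIx S₂ (proj₂ s) →
            A × (DMTS.S S₁ × DMTS.S S₂) → Set
    mustC (s₁ , s₂) (inj₁ i) (a , t₁ , t₂) =
      DMTS.must S₁ s₁ i (a , t₁) × mayC (s₁ , s₂) (a , t₁ , t₂)
    mustC (s₁ , s₂) (inj₂ j) (a , t₁ , t₂) =
      DMTS.must S₂ s₂ j (a , t₂) × mayC (s₁ , s₂) (a , t₁ , t₂)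

    must⊆mayC : ∀ s i x → mustC s i x → mayC s x
    must⊆mayC (s₁ , s₂) (inj₁ i) (a , t₁ , t₂) (_ , m) = m
    must⊆mayC (s₁ , s₂) (inj₂ j) (a , t₁ , t₂) (_ , m) = m

-- Conjunction is the greatest lower bound for modal refinement: the projections
-- exhibit S₂ ∧ S₃ ≤ S₂ and S₂ ∧ S₃ ≤ S₃, refinement is transitive (compose the
-- witnessing relations), and refinements R₂ : S₁ ≤ S₂ and R₃ : S₁ ≤ S₃ combine
-- into {(s, (s₂, s₃)) | R₂ s s₂, R₃ s s₃} : S₁ ≤ S₂ ∧ S₃. The semantic statement
-- is the instance S₁ = I. For NAA the only real work is to assemble, from
-- acceptance sets M₂ and M₃ matching the same M₁, a set M of triples whose
-- projections are M₂ and M₃.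
module Submission where

open import Defs
open import Level using (0ℓ)
open import Data.Nat using (ℕ)
open import Data.Fin using (Fin)
open import Data.Product using (Σ; ∃-syntax; _×_; _,_; proj₁; proj₂; uncurry)
open import Data.Sum using (inj₁; inj₂)
open import Data.List using (List; _++_; map; cartesianProduct)
open import Data.List.Relation.Unary.Any using (here; there)
open import Data.List.Membership.Propositional using (_∈_; mapWith∈)
open import Data.List.Membership.Propositional.Properties
  using (∈-map⁺; ∈-map⁻; ∈-++⁺ˡ; ∈-++⁺ʳ; ∈-cartesianProduct⁺; ∈-cartesianProduct⁻)
open import Data.List.Relation.Binary.BagAndSetEquality using (_∼[_]_; set)
open import Function.Bundles using (_⇔_; mk⇔; Equivalence)
open import Relation.Binary.Core using (REL)
open import Relation.Binary.PropositionalEquality using (_≡_; refl)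

∈-mapWith∈⁺ : {X Y : Set} {xs : List X} {x : X} (f : ∀ {y} → y ∈ xs → Y) (x∈xs : x ∈ xs) →
              f x∈xs ∈ mapWith∈ xs f
∈-mapWith∈⁺ f (here refl) = here refl
∈-mapWith∈⁺ f (there x∈xs) = there (∈-mapWith∈⁺ (λ y∈xs → f (there y∈xs)) x∈xs)

-- Relation.Binary.Construct.Composition._;_ cannot be referred to: ';' is reserved.
_⨾_ : {X Y Z : Set} → REL X Y 0ℓ → REL Y Z 0ℓ → REL X Z 0ℓ
(R ⨾ R′) x z = ∃[ y ] (R x y × R′ y z)

Initialised : {X Y : Set} → REL X Y 0ℓ → List X → List Y → Set
Initialised R xs ys = ∀ x → x ∈ xs → ∃[ y ] (y ∈ ys × R x y)

module _ {X Y Z : Set} {xs : List X} {ys : List Y} {zs : List Z} where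

  Initialised-trans : {R : REL X Y 0ℓ} {R′ : REL Y Z 0ℓ} →
                      Initialised R xs ys → Initialised R′ ys zs → Initialised (R ⨾ R′) xs zs
  Initialised-trans ini ini′ x x∈ with ini x x∈
  ... | y , y∈ , r with ini′ y y∈
  ... | z , z∈ , r′ = z , z∈ , y , r , r′

  Initialised-∩ : {R : REL X Y 0ℓ} {R′ : REL X Z 0ℓ} →
                  Initialised R xs ys → Initialised R′ xs zs →
                  Initialised (λ x p → R x (proj₁ p) × R′ x (proj₂ p)) xs (cartesianProduct ys zs)
  Initialised-∩ ini ini′ x x∈ with ini x x∈ | ini′ x x∈
  ... | y , y∈ , r | z , z∈ , r′ = (y , z) , ∈-cartesianProduct⁺ y∈ z∈ , r , r′

module _ {X Y : Set} (xs : List X) (ys : List Y) where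

  Initialised-proj₁ : Initialised (λ p → proj₁ p ≡_) (cartesianProduct xs ys) xs
  Initialised-proj₁ (x , y) p∈ = x , proj₁ (∈-cartesianProduct⁻ xs ys p∈) , refl

  Initialised-proj₂ : Initialised (λ p → proj₂ p ≡_) (cartesianProduct xs ys) ys
  Initialised-proj₂ (x , y) p∈ = y , proj₂ (∈-cartesianProduct⁻ xs ys p∈) , refl

module _ {A : Set} where

  Matches : {S T : Set} → REL S T 0ℓ → List (A × S) → List (A × T) → Set
  Matches R M N = (∀ a s → (a , s) ∈ M → ∃[ t ] ((a , t) ∈ N × R s t))
                × (∀ a t → (a , t) ∈ N → ∃[ s ] ((a , s) ∈ M × R s t))

  module _ {S T U : Set} {M : List (A × S)} {N : List (A × T)} {O : List (A × U)} where

    Matches-trans : {R : REL S T 0ℓ} {R′ : REL T U 0ℓ} →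
                    Matches R M N → Matches R′ N O → Matches (R ⨾ R′) M O
    Matches-trans {R} {R′} (fw , bw) (fw′ , bw′) = fw″ , bw″
      where
      fw″ : ∀ a s → (a , s) ∈ M → ∃[ u ] ((a , u) ∈ O × (R ⨾ R′) s u)
      fw″ a s s∈ with fw a s s∈
      ... | t , t∈ , r with fw′ a t t∈
      ... | u , u∈ , r′ = u , u∈ , t , r , r′
      bw″ : ∀ a u → (a , u) ∈ O → ∃[ s ] ((a , s) ∈ M × (R ⨾ R′) s u)
      bw″ a u u∈ with bw′ a u u∈
      ... | t , t∈ , r′ with bw a t t∈
      ... | s , s∈ , r = s , s∈ , t , r , r′

  module _ {S T : Set} {M : List (A × S × T)} where

    Matches-π₁ : {N : List (A × S)} → π₁ M ∼[ set ] N → Matches (λ p → proj₁ p ≡_) M N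
    Matches-π₁ {N} π₁M∼N = fw , bw
      where
      fw : ∀ a p → (a , p) ∈ M → ∃[ s ] ((a , s) ∈ N × proj₁ p ≡ s)
      fw a (s , t) p∈ = s , Equivalence.to π₁M∼N (∈-map⁺ _ p∈) , refl
      bw : ∀ a s → (a , s) ∈ N → ∃[ p ] ((a , p) ∈ M × proj₁ p ≡ s)
      bw a s s∈ with ∈-map⁻ _ (Equivalence.from π₁M∼N s∈)
      ... | (.a , .s , t) , p∈ , refl = (s , t) , p∈ , refl

    Matches-π₂ : {N : List (A × T)} → π₂ M ∼[ set ] N → Matches (λ p → proj₂ p ≡_) M N
    Matches-π₂ {N} π₂M∼N = fw , bw
      where
      fw : ∀ a p → (a , p) ∈ M → ∃[ t ] ((a , t) ∈ N × proj₂ p ≡ t)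
      fw a (s , t) p∈ = t , Equivalence.to π₂M∼N (∈-map⁺ _ p∈) , refl
      bw : ∀ a t → (a , t) ∈ N → ∃[ p ] ((a , p) ∈ M × proj₂ p ≡ t)
      bw a t t∈ with ∈-map⁻ _ (Equivalence.from π₂M∼N t∈)
      ... | (.a , s , .t) , p∈ , refl = (s , t) , p∈ , refl

  -- Every element of M, N and O contributes one triple, completed through the
  -- matchings (for an element of N: back to M, then forward to O).
  Matches-pair : {S T U : Set} {R : REL S T 0ℓ} {R′ : REL S U 0ℓ}
                 {M : List (A × S)} {N : List (A × T)} {O : List (A × U)} →
                 Matches R M N → Matches R′ M O →
                 ∃[ P ] (π₁ P ∼[ set ] N × π₂ P ∼[ set ] O
                         × Matches (λ s p → R s (proj₁ p) × R′ s (proj₂ p)) M P)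
  Matches-pair {S} {T} {U} {R} {R′} {M} {N} {O} (fw , bw) (fw′ , bw′) =
    map proj₁ triples , mk⇔ π₁⊆N N⊆π₁ , mk⇔ π₂⊆O O⊆π₂ , fw″ , bw″
    where
    Joint : A × T × U → Set
    Joint (a , t , u) = ∃[ s ] ((a , s) ∈ M × (a , t) ∈ N × (a , u) ∈ O × R s t × R′ s u)

    fromM : ∀ {x} → x ∈ M → Σ _ Joint
    fromM {a , s} s∈ =
      let t , t∈ , r = fw a s s∈; u , u∈ , r′ = fw′ a s s∈
      in (a , t , u) , s , s∈ , t∈ , u∈ , r , r′

    fromN : ∀ {x} → x ∈ N → Σ _ Joint
    fromN {a , t} t∈ with bw a t t∈
    ... | s , s∈ , r with fw′ a s s∈
    ... | u , u∈ , r′ = (a , t , u) , s , s∈ , t∈ , u∈ , r , r′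

    fromO : ∀ {x} → x ∈ O → Σ _ Joint
    fromO {a , u} u∈ with bw′ a u u∈
    ... | s , s∈ , r′ with fw a s s∈
    ... | t , t∈ , r = (a , t , u) , s , s∈ , t∈ , u∈ , r , r′

    triples : List (Σ _ Joint)
    triples = mapWith∈ M fromM ++ mapWith∈ N fromN ++ mapWith∈ O fromO

    joint : ∀ {x} → x ∈ map proj₁ triples → Joint x
    joint x∈ with ∈-map⁻ proj₁ x∈
    ... | (x , j) , _ , refl = j

    π₁⊆N : ∀ {x} → x ∈ π₁ (map proj₁ triples) → x ∈ N
    π₁⊆N x∈ with ∈-map⁻ _ x∈
    ... | _ , p∈ , refl with joint p∈
    ... | _ , _ , t∈ , _ = t∈

    π₂⊆O : ∀ {x} → x ∈ π₂ (map proj₁ triples) → x ∈ O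
    π₂⊆O x∈ with ∈-map⁻ _ x∈
    ... | _ , p∈ , refl with joint p∈
    ... | _ , _ , _ , u∈ , _ = u∈

    N⊆π₁ : ∀ {x} → x ∈ N → x ∈ π₁ (map proj₁ triples)
    N⊆π₁ {a , t} t∈ = ∈-map⁺ _ (∈-map⁺ proj₁
      (∈-++⁺ʳ (mapWith∈ M fromM) (∈-++⁺ˡ (∈-mapWith∈⁺ fromN t∈))))

    O⊆π₂ : ∀ {x} → x ∈ O → x ∈ π₂ (map proj₁ triples)
    O⊆π₂ {a , u} u∈ = ∈-map⁺ _ (∈-map⁺ proj₁
      (∈-++⁺ʳ (mapWith∈ M fromM) (∈-++⁺ʳ (mapWith∈ N fromN) (∈-mapWith∈⁺ fromO u∈))))

    fw″ : ∀ a s → (a , s) ∈ M →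
          ∃[ p ] ((a , p) ∈ map proj₁ triples × R s (proj₁ p) × R′ s (proj₂ p))
    fw″ a s s∈ =
      let t , _ , r = fw a s s∈; u , _ , r′ = fw′ a s s∈
      in (t , u) , ∈-map⁺ proj₁ (∈-++⁺ˡ (∈-mapWith∈⁺ fromM s∈)) , r , r′

    bw″ : ∀ a p → (a , p) ∈ map proj₁ triples →
          ∃[ s ] ((a , s) ∈ M × R s (proj₁ p) × R′ s (proj₂ p))
    bw″ a p p∈ with joint p∈
    ... | s , s∈ , _ , _ , r , r′ = s , s∈ , r , r′

module _ {A : Set} {S₁ S₂ S₃ : NAA A} where

  ≤NAA-trans : S₁ ≤NAA S₂ → S₂ ≤NAA S₃ → S₁ ≤NAA S₃
  ≤NAA-trans (R , ref , ini) (R′ , ref′ , ini′) = R ⨾ R′ , ref″ , Initialised-trans ini ini′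
    where
    ref″ : IsNAARefinement S₁ S₃ (R ⨾ R′)
    ref″ s₁ s₃ (s₂ , r , r′) M₁ tr₁ with ref s₁ s₂ r M₁ tr₁
    ... | M₂ , tr₂ , M₁≈M₂ with ref′ s₂ s₃ r′ M₂ tr₂
    ... | M₃ , tr₃ , M₂≈M₃ = M₃ , tr₃ , Matches-trans M₁≈M₂ M₂≈M₃

  ∧NAA-greatest : S₁ ≤NAA S₂ → S₁ ≤NAA S₃ → S₁ ≤NAA (S₂ ∧NAA S₃)
  ∧NAA-greatest (R , ref , ini) (R′ , ref′ , ini′) = R∩R′ , ref″ , Initialised-∩ ini ini′
    where
    R∩R′ : REL (NAA.S S₁) (NAA.S S₂ × NAA.S S₃) 0ℓ
    R∩R′ s (s₂ , s₃) = R s s₂ × R′ s s₃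

    ref″ : IsNAARefinement S₁ (S₂ ∧NAA S₃) R∩R′
    ref″ s (s₂ , s₃) (r , r′) M₁ tr₁ with ref s s₂ r M₁ tr₁ | ref′ s s₃ r′ M₁ tr₁
    ... | M₂ , tr₂ , M₁≈M₂ | M₃ , tr₃ , M₁≈M₃ with Matches-pair M₁≈M₂ M₁≈M₃
    ... | M , π₁M∼M₂ , π₂M∼M₃ , M₁≈M = M , ((M₂ , tr₂ , π₁M∼M₂) , (M₃ , tr₃ , π₂M∼M₃)) , M₁≈M

module _ {A : Set} (S₁ S₂ : NAA A) where

  ∧NAA-≤ˡ : (S₁ ∧NAA S₂) ≤NAA S₁
  ∧NAA-≤ˡ = (λ p → proj₁ p ≡_) , ref , Initialised-proj₁ (NAA.S⁰ S₁) (NAA.S⁰ S₂)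
    where
    ref : IsNAARefinement (S₁ ∧NAA S₂) S₁ (λ p → proj₁ p ≡_)
    ref (s₁ , s₂) .s₁ refl M ((M₁ , tr₁ , π₁M∼M₁) , _) = M₁ , tr₁ , Matches-π₁ π₁M∼M₁

  ∧NAA-≤ʳ : (S₁ ∧NAA S₂) ≤NAA S₂
  ∧NAA-≤ʳ = (λ p → proj₂ p ≡_) , ref , Initialised-proj₂ (NAA.S⁰ S₁) (NAA.S⁰ S₂)
    where
    ref : IsNAARefinement (S₁ ∧NAA S₂) S₂ (λ p → proj₂ p ≡_)
    ref (s₁ , s₂) .s₂ refl M (_ , (M₂ , tr₂ , π₂M∼M₂)) = M₂ , tr₂ , Matches-π₂ π₂M∼M₂

∧NAA-glb : {A : Set} (S₁ S₂ S₃ : NAA A) →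
           S₁ ≤NAA (S₂ ∧NAA S₃) ⇔ (S₁ ≤NAA S₂ × S₁ ≤NAA S₃)
∧NAA-glb S₁ S₂ S₃ =
  mk⇔ (λ ≤∧ → ≤NAA-trans {S₁ = S₁} ≤∧ (∧NAA-≤ˡ S₂ S₃) , ≤NAA-trans {S₁ = S₁} ≤∧ (∧NAA-≤ʳ S₂ S₃))
      (uncurry (∧NAA-greatest {S₁ = S₁}))

module _ {A : Set} {S₁ S₂ S₃ : DMTS A} where
  open DMTS using (may; must; must⊆may)

  ≤DMTS-trans : S₁ ≤DMTS S₂ → S₂ ≤DMTS S₃ → S₁ ≤DMTS S₃
  ≤DMTS-trans (R , ref , ini) (R′ , ref′ , ini′) = R ⨾ R′ , ref″ , Initialised-trans ini ini′
    where
    ref″ : IsDMTSRefinement S₁ S₃ (R ⨾ R′)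
    ref″ s₁ s₃ (s₂ , r , r′) = mayStep , mustStep
      where
      mayStep : ∀ a t₁ → may S₁ s₁ (a , t₁) → ∃[ t₃ ] (may S₃ s₃ (a , t₃) × (R ⨾ R′) t₁ t₃)
      mayStep a t₁ m₁ with proj₁ (ref s₁ s₂ r) a t₁ m₁
      ... | t₂ , m₂ , q with proj₁ (ref′ s₂ s₃ r′) a t₂ m₂
      ... | t₃ , m₃ , q′ = t₃ , m₃ , t₂ , q , q′

      mustStep : ∀ k → ∃[ i ] (∀ a t₁ → must S₁ s₁ i (a , t₁) →
                   ∃[ t₃ ] (must S₃ s₃ k (a , t₃) × (R ⨾ R′) t₁ t₃))
      mustStep k with proj₂ (ref′ s₂ s₃ r′) k
      ... | j , j⇒k with proj₂ (ref s₁ s₂ r) j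
      ... | i , i⇒j = i , i⇒k
        where
        i⇒k : ∀ a t₁ → must S₁ s₁ i (a , t₁) → ∃[ t₃ ] (must S₃ s₃ k (a , t₃) × (R ⨾ R′) t₁ t₃)
        i⇒k a t₁ u₁ with i⇒j a t₁ u₁
        ... | t₂ , u₂ , q with j⇒k a t₂ u₂
        ... | t₃ , u₃ , q′ = t₃ , u₃ , t₂ , q , q′

  ∧DMTS-greatest : S₁ ≤DMTS S₂ → S₁ ≤DMTS S₃ → S₁ ≤DMTS (S₂ ∧DMTS S₃)
  ∧DMTS-greatest (R , ref , ini) (R′ , ref′ , ini′) = R∩R′ , ref″ , Initialised-∩ ini ini′
    where
    R∩R′ : REL (DMTS.S S₁) (DMTS.S S₂ × DMTS.S S₃) 0ℓ
    R∩R′ s (s₂ , s₃) = R s s₂ × R′ s s₃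

    ref″ : IsDMTSRefinement S₁ (S₂ ∧DMTS S₃) R∩R′
    ref″ s (s₂ , s₃) (r , r′) = mayStep , mustStep
      where
      mayStep : ∀ a t → may S₁ s (a , t) →
                ∃[ p ] (may (S₂ ∧DMTS S₃) (s₂ , s₃) (a , p) × R∩R′ t p)
      mayStep a t m with proj₁ (ref s s₂ r) a t m | proj₁ (ref′ s s₃ r′) a t m
      ... | t₂ , m₂ , q | t₃ , m₃ , q′ = (t₂ , t₃) , (m₂ , m₃) , q , q′

      -- A must transition of one conjunct is answered by the corresponding
      -- refinement; the other component is any may successor, available because
      -- must transitions are may transitions.
      mustStep : ∀ k → ∃[ i ] (∀ a t → must S₁ s i (a , t) →
                   ∃[ p ] (must (S₂ ∧DMTS S₃) (s₂ , s₃) k (a , p) × R∩R′ t p))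
      mustStep (inj₁ j) with proj₂ (ref s s₂ r) j
      ... | i , i⇒j = i , λ a t u → answer a t u (i⇒j a t u)
        where
        answer : ∀ a t → must S₁ s i (a , t) → ∃[ t₂ ] (must S₂ s₂ j (a , t₂) × R t t₂) →
                 ∃[ p ] (must (S₂ ∧DMTS S₃) (s₂ , s₃) (inj₁ j) (a , p) × R∩R′ t p)
        answer a t u (t₂ , u₂ , q) with proj₁ (ref′ s s₃ r′) a t (must⊆may S₁ s i _ u)
        ... | t₃ , m₃ , q′ = (t₂ , t₃) , (u₂ , must⊆may S₂ s₂ j _ u₂ , m₃) , q , q′
      mustStep (inj₂ j) with proj₂ (ref′ s s₃ r′) j
      ... | i , i⇒j = i , λ a t u → answer a t u (i⇒j a t u)
        where
        answer : ∀ a t → must S₁ s i (a , t) → ∃[ t₃ ] (must S₃ s₃ j (a , t₃) × R′ t t₃) →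
                 ∃[ p ] (must (S₂ ∧DMTS S₃) (s₂ , s₃) (inj₂ j) (a , p) × R∩R′ t p)
        answer a t u (t₃ , u₃ , q′) with proj₁ (ref s s₂ r) a t (must⊆may S₁ s i _ u)
        ... | t₂ , m₂ , q = (t₂ , t₃) , (u₃ , m₂ , must⊆may S₃ s₃ j _ u₃) , q , q′

module _ {A : Set} (S₁ S₂ : DMTS A) where
  open DMTS using (may; must)

  ∧DMTS-≤ˡ : (S₁ ∧DMTS S₂) ≤DMTS S₁
  ∧DMTS-≤ˡ = (λ p → proj₁ p ≡_) , ref , Initialised-proj₁ (DMTS.S⁰ S₁) (DMTS.S⁰ S₂)
    where
    ref : IsDMTSRefinement (S₁ ∧DMTS S₂) S₁ (λ p → proj₁ p ≡_)
    ref (s₁ , s₂) .s₁ refl =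
      (λ { a (t₁ , t₂) (m₁ , _) → t₁ , m₁ , refl }) ,
      (λ j → inj₁ j , λ { a (t₁ , t₂) (u₁ , _) → t₁ , u₁ , refl })

  ∧DMTS-≤ʳ : (S₁ ∧DMTS S₂) ≤DMTS S₂
  ∧DMTS-≤ʳ = (λ p → proj₂ p ≡_) , ref , Initialised-proj₂ (DMTS.S⁰ S₁) (DMTS.S⁰ S₂)
    where
    ref : IsDMTSRefinement (S₁ ∧DMTS S₂) S₂ (λ p → proj₂ p ≡_)
    ref (s₁ , s₂) .s₂ refl =
      (λ { a (t₁ , t₂) (_ , m₂) → t₂ , m₂ , refl }) ,
      (λ j → inj₂ j , λ { a (t₁ , t₂) (u₂ , _) → t₂ , u₂ , refl })

∧DMTS-glb : {A : Set} (S₁ S₂ S₃ : DMTS A) →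
           S₁ ≤DMTS (S₂ ∧DMTS S₃) ⇔ (S₁ ≤DMTS S₂ × S₁ ≤DMTS S₃)
∧DMTS-glb S₁ S₂ S₃ =
  mk⇔ (λ ≤∧ → ≤DMTS-trans {S₁ = S₁} {S₂ ∧DMTS S₃} {S₂} ≤∧ (∧DMTS-≤ˡ S₂ S₃)
             , ≤DMTS-trans {S₁ = S₁} {S₂ ∧DMTS S₃} {S₃} ≤∧ (∧DMTS-≤ʳ S₂ S₃))
      (uncurry (∧DMTS-greatest {S₁ = S₁}))

theorem3 :
    (∀ (n : ℕ) (S₁ S₂ S₃ : NAA (Fin n)) →
        (∀ (I : LTS (Fin n)) →
           (I ∈⟦ S₁ ∧NAA S₂ ⟧NAA) ⇔ ((I ∈⟦ S₁ ⟧NAA) × (I ∈⟦ S₂ ⟧NAA)))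
      × ((S₁ ≤NAA (S₂ ∧NAA S₃)) ⇔ ((S₁ ≤NAA S₂) × (S₁ ≤NAA S₃))))
    ×
    (∀ (n : ℕ) (S₁ S₂ S₃ : DMTS (Fin n)) →
        ImageFinite S₁ → ImageFinite S₂ → ImageFinite S₃ →
        (∀ (I : LTS (Fin n)) →
           (I ∈⟦ S₁ ∧DMTS S₂ ⟧DMTS) ⇔ ((I ∈⟦ S₁ ⟧DMTS) × (I ∈⟦ S₂ ⟧DMTS)))
      × ((S₁ ≤DMTS (S₂ ∧DMTS S₃)) ⇔ ((S₁ ≤DMTS S₂) × (S₁ ≤DMTS S₃))))
theorem3 =
  (λ _ S₁ S₂ S₃ → (λ I → ∧NAA-glb (LTS→NAA I) S₁ S₂) , ∧NAA-glb S₁ S₂ S₃) ,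
  (λ _ S₁ S₂ S₃ _ _ _ → (λ I → ∧DMTS-glb (LTS→DMTS I) S₁ S₂) , ∧DMTS-glb S₁ S₂ S₃)
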